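{- Let $G$ be a spanning subgraph of $Q_n$ and $xy\in E(Q_n)$. If $\tilde G$ contains at least $4$ staples on $xy$, then $xy\in E(\tilde G)$.
   Context: $Q_n$ is the $n$-cube (graph on $\{0,1\}^n$, $x,y$ adjacent iff they differ in exactly one component). For a spanning subgraph $G$ of $Q_n$, an embedding of $G$ is a permutation $\pi$ of $\{0,1\}^n$ with $\pi(x)\pi(y)\in E(Q_n)$ for all $xy\in E(G)$; an edge $xy\in E(Q_n)$ is solid in $G$ if $\pi(x)\pi(y)\in E(Q_n)$ for every embedding $\pi$ of $G$; $\tilde G$ is obtained from $G$ by adding all edges of $Q_n$ solid in $G$. A staple on an edge $xy$ of $Q_n$ is a path of length $3$ in $Q_n$ between $x$ and $y$, i.e. a set of three edges of $Q_n$ of the form $\{xx',x'y',y'y\}$; $\tilde G$ contains the staple if all three edges are edges of $\tilde G$. -}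

module Defs where

open import Data.Nat using (ℕ)
open import Data.Bool using (Bool; not)
open import Data.Fin using (Fin)
open import Data.Vec using (Vec; _[_]%=_)
open import Data.Product using (Σ; _×_; _,_)
open import Data.Sum using (_⊎_)
open import Relation.Binary.PropositionalEquality using (_≡_; _≢_)
open import Relation.Nullary using (¬_)
open import Function.Bundles using (_⤖_; Bijection)
open import Function.Definitions using (Injective)

V : ℕ → Set
V n = Vec Bool n

Adj : ∀ {n} → V n → V n → Set
Adj {n} x y = Σ (Fin n) λ i → y ≡ (x [ i ]%= not)

record SpanningSubgraph (n : ℕ) : Set₁ where
  field
    E     : V n → V n → Set
    sym   : ∀ {x y} → E x y → E y x
    inQn  : ∀ {x y} → E x y → Adj x y

open SpanningSubgraph public

IsEmbedding : ∀ {n} → SpanningSubgraph n → (V n → V n) → Set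
IsEmbedding G π = ∀ x y → E G x y → Adj (π x) (π y)

Solid : ∀ {n} → SpanningSubgraph n → V n → V n → Set
Solid {n} G x y = Adj x y ×
  ((π : V n ⤖ V n) → IsEmbedding G (Bijection.to π) → Adj (Bijection.to π x) (Bijection.to π y))

EdgeTilde : ∀ {n} → SpanningSubgraph n → V n → V n → Set
EdgeTilde G x y = E G x y ⊎ Solid G x y

-- a staple on xy given by its middle vertices (x', y'): the path x – x' – y' – y
-- of length 3 in Q_n (vertices pairwise distinct; the remaining distinctness
-- conditions follow from adjacency in Q_n)
IsStaple : ∀ {n} → V n → V n → V n × V n → Set
IsStaple x y (x' , y') = Adj x x' × Adj x' y' × Adj y' y × x' ≢ y × y' ≢ x

TildeContainsStaple : ∀ {n} → SpanningSubgraph n → V n → V n → V n × V n → Set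
TildeContainsStaple G x y (x' , y') =
  IsStaple x y (x' , y') × EdgeTilde G x x' × EdgeTilde G x' y' × EdgeTilde G y' y

AtLeast4Staples : ∀ {n} → SpanningSubgraph n → V n → V n → Set
AtLeast4Staples {n} G x y =
  Σ (Fin 4 → V n × V n) λ s → Injective _≡_ _≡_ s × (∀ i → TildeContainsStaple G x y (s i))

{-# OPTIONS --safe #-}
-- Every staple on xy has the form x, x + eᵢ, x + eᵢ + eⱼ, y = x + eⱼ, so distinct staples
-- have distinct first directions i.  An embedding π of G is also an embedding of G̃, so it
-- maps each staple to a walk of length 3 from π x to π y.  If π x and π y are not adjacent,
-- the first direction of each image walk is a coordinate in which π x and π y differ, and
-- there are at most three such coordinates; but the four image walks leave π x in four
-- distinct directions, because π is injective.
module Submission where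

open import Defs hiding (sym)
open import Data.Nat using (ℕ; _<_)
open import Data.Nat.Properties using (≤-refl)
open import Data.Bool using (not)
open import Data.Bool.Properties using (not-involutive; not-¬) renaming (_≟_ to _≟ᵇ_)
open import Data.Fin using (Fin; zero; _≟_)
open import Data.Fin.Properties using (any?; pigeonhole; <⇒≢)
open import Data.Vec using (Vec; []; _∷_; lookup; _[_]%=_)
open import Data.Vec.Properties
  using (≡-dec; lookup∘updateAt; lookup∘updateAt′; updateAt-updateAt-local; updateAt-id; updateAt-commutes)
open import Data.Vec.Relation.Unary.Any using (here; there; index)
open import Data.Vec.Relation.Unary.Any.Properties using (lookup-index)
open import Data.Vec.Membership.Propositional using (_∈_)
open import Data.Product using (_×_; _,_; proj₁; proj₂)
open import Data.Sum using (inj₁; inj₂)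
open import Data.Empty using (⊥-elim)
open import Relation.Nullary using (¬_; yes; no; contradiction)
open import Relation.Binary.Definitions using (Decidable)
open import Relation.Binary.PropositionalEquality
  using (_≡_; _≢_; refl; sym; trans; cong; cong₂; module ≡-Reasoning)
open import Function.Bundles using (_⤖_; Bijection)
open import Function.Definitions using (Injective)

private
  variable
    n : ℕ
    i j p q r m : Fin n
    u v x y : V n

flip : Fin n → V n → V n
flip i x = x [ i ]%= not

lookup-flip-≡ : ∀ i (x : V n) → lookup (flip i x) i ≡ not (lookup x i)
lookup-flip-≡ i x = lookup∘updateAt i x

lookup-flip-≢ : ∀ i (x : V n) → j ≢ i → lookup (flip i x) j ≡ lookup x j
lookup-flip-≢ {j = j} i x j≢i = lookup∘updateAt′ j i j≢i x

flip-changes : ∀ i (x : V n) → lookup (flip i x) i ≢ lookup x i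
flip-changes i x e = not-¬ refl (trans (sym e) (lookup-flip-≡ i x))

flip-involutive : ∀ i (x : V n) → flip i (flip i x) ≡ x
flip-involutive i x = trans (updateAt-updateAt-local i x (not-involutive _)) (updateAt-id i x)

flip-comm : ∀ i j (x : V n) → flip i (flip j x) ≡ flip j (flip i x)
flip-comm i j x with i ≟ j
... | yes refl = refl
... | no i≢j   = updateAt-commutes i j i≢j x

flip-injectiveˡ : flip i x ≡ flip j x → i ≡ j
flip-injectiveˡ {i = i} {x = x} {j = j} e with i ≟ j
... | yes i≡j = i≡j
... | no i≢j  =
  contradiction (trans (cong (λ z → lookup z i) e) (lookup-flip-≢ j x i≢j)) (flip-changes i x)

Adj? : Decidable (Adj {n})
Adj? x y = any? λ i → ≡-dec _≟ᵇ_ y (flip i x)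

flip³-adj : (ux : Adj u x) (xy : Adj x y) (yv : Adj y v) →
  v ≡ flip (proj₁ yv) (flip (proj₁ xy) (flip (proj₁ ux) u))
flip³-adj (p , refl) (q , refl) (r , refl) = refl

flip³-changes⇒∈ : v ≡ flip r (flip q (flip p u)) → lookup v m ≢ lookup u m → m ∈ p ∷ q ∷ r ∷ []
flip³-changes⇒∈ {r = r} {q = q} {p = p} {u = u} {m = m} refl changes with m ≟ p | m ≟ q | m ≟ r
... | yes m≡p | _       | _       = here m≡p
... | no _    | yes m≡q | _       = there (here m≡q)
... | no _    | no _    | yes m≡r = there (there (here m≡r))
... | no m≢p  | no m≢q  | no m≢r  = contradiction unchanged changes
  where
  open ≡-Reasoning
  unchanged : lookup (flip r (flip q (flip p u))) m ≡ lookup u m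
  unchanged = begin
    lookup (flip r (flip q (flip p u))) m ≡⟨ lookup-flip-≢ r (flip q (flip p u)) m≢r ⟩
    lookup (flip q (flip p u)) m          ≡⟨ lookup-flip-≢ q (flip p u) m≢q ⟩
    lookup (flip p u) m                   ≡⟨ lookup-flip-≢ p u m≢p ⟩
    lookup u m                            ∎

-- The hypothesis rules out p cancelling against q or r.
flip³-changes-first : v ≡ flip r (flip q (flip p u)) → ¬ Adj u v → lookup v p ≢ lookup u p
flip³-changes-first {r = r} {q = q} {p = p} {u = u} refl ¬adj with p ≟ q | p ≟ r
... | yes refl | _        = contradiction (r , cong (flip r) (flip-involutive p u)) ¬adj
... | no _     | yes refl = contradiction (q , cancel) ¬adj
  where
  cancel : flip p (flip q (flip p u)) ≡ flip q u
  cancel = trans (flip-comm p q (flip p u)) (cong (flip q) (flip-involutive p u))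
... | no p≢q   | no p≢r   = λ e → flip-changes p u (begin
    lookup (flip p u) p                   ≡⟨ lookup-flip-≢ q (flip p u) p≢q ⟨
    lookup (flip q (flip p u)) p          ≡⟨ lookup-flip-≢ r (flip q (flip p u)) p≢r ⟨
    lookup (flip r (flip q (flip p u))) p ≡⟨ e ⟩
    lookup u p                            ∎)
  where open ≡-Reasoning

staple-parallel : y ≡ flip j x → ∀ {x' y'} → IsStaple x y (x' , y') → y' ≡ flip j x'
staple-parallel {j = j} {x = x} refl ((i , refl) , (l , refl) , (m , y≡) , x'≢y , y'≢x) =
  cong (λ k → flip k (flip i x)) l≡j
  where
  i≢j : i ≢ j
  i≢j refl = x'≢y refl
  l≢i : l ≢ i
  l≢i refl = y'≢x (flip-involutive i x)
  l≡j : l ≡ j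
  l≡j with l ≟ j | l ≟ m
  ... | yes l≡j | _        = l≡j
  ... | no l≢j  | yes refl =
    contradiction (flip-injectiveˡ (sym (trans y≡ (flip-involutive m (flip i x))))) i≢j
  ... | no l≢j  | no l≢m   = contradiction (begin
      lookup (flip l (flip i x)) l          ≡⟨ lookup-flip-≢ m (flip l (flip i x)) l≢m ⟨
      lookup (flip m (flip l (flip i x))) l ≡⟨ cong (λ z → lookup z l) y≡ ⟨
      lookup (flip j x) l                   ≡⟨ lookup-flip-≢ j x l≢j ⟩
      lookup x l                            ≡⟨ lookup-flip-≢ i x l≢i ⟨
      lookup (flip i x) l                   ∎) (flip-changes l (flip i x))
    where open ≡-Reasoning

∈-pigeonhole : ∀ {a} {A : Set a} {k l} (xs : Vec A k) (c : Fin l → A) → k < l →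
  (∀ i → c i ∈ xs) → ¬ Injective _≡_ _≡_ c
∈-pigeonhole xs c k<l c∈xs c-inj with pigeonhole k<l (λ i → index (c∈xs i))
... | i , j , i<j , same-index = <⇒≢ i<j (c-inj (begin
    c i                        ≡⟨ lookup-index (c∈xs i) ⟩
    lookup xs (index (c∈xs i)) ≡⟨ cong (lookup xs) same-index ⟩
    lookup xs (index (c∈xs j)) ≡⟨ lookup-index (c∈xs j) ⟨
    c j                        ∎))
  where open ≡-Reasoning

MapsStapleToWalk : (V n → V n) → V n → V n → V n × V n → Set
MapsStapleToWalk f x y (x' , y') = Adj (f x) (f x') × Adj (f x') (f y') × Adj (f y') (f y)

four-staple-images-adjacent : (f : V n → V n) → Injective _≡_ _≡_ f → Adj x y →
  (s : Fin 4 → V n × V n) → Injective _≡_ _≡_ s → (∀ k → IsStaple x y (s k)) →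
  (∀ k → MapsStapleToWalk f x y (s k)) → Adj (f x) (f y)
four-staple-images-adjacent {x = x} {y = y} f f-inj (j , y≡) s s-inj staple walk
  with Adj? (f x) (f y)
... | yes adj = adj
... | no ¬adj = ⊥-elim (∈-pigeonhole (P zero ∷ Q zero ∷ R zero ∷ []) P ≤-refl P∈ P-inj)
  where
  P Q R : Fin 4 → Fin _
  P k = proj₁ (proj₁ (walk k))
  Q k = proj₁ (proj₁ (proj₂ (walk k)))
  R k = proj₁ (proj₂ (proj₂ (walk k)))
  fy≡ : ∀ k → f y ≡ flip (R k) (flip (Q k) (flip (P k) (f x)))
  fy≡ k = let (fxx' , fx'y' , fy'y) = walk k in flip³-adj fxx' fx'y' fy'y
  P∈ : ∀ k → P k ∈ P zero ∷ Q zero ∷ R zero ∷ []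
  P∈ k = flip³-changes⇒∈ (fy≡ zero) (flip³-changes-first (fy≡ k) ¬adj)
  P-inj : Injective _≡_ _≡_ P
  P-inj {k} {l} Pk≡Pl = s-inj (cong₂ _,_ x'k≡x'l (begin
      proj₂ (s k)          ≡⟨ staple-parallel y≡ (staple k) ⟩
      flip j (proj₁ (s k)) ≡⟨ cong (flip j) x'k≡x'l ⟩
      flip j (proj₁ (s l)) ≡⟨ staple-parallel y≡ (staple l) ⟨
      proj₂ (s l)          ∎))
    where
    open ≡-Reasoning
    x'k≡x'l : proj₁ (s k) ≡ proj₁ (s l)
    x'k≡x'l = f-inj (begin
      f (proj₁ (s k))  ≡⟨ proj₂ (proj₁ (walk k)) ⟩
      flip (P k) (f x) ≡⟨ cong (λ i → flip i (f x)) Pk≡Pl ⟩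
      flip (P l) (f x) ≡⟨ proj₂ (proj₁ (walk l)) ⟨
      f (proj₁ (s l))  ∎)

embedding-preserves-tilde : ∀ (G : SpanningSubgraph n) (π : V n ⤖ V n) →
  IsEmbedding G (Bijection.to π) → EdgeTilde G x y → Adj (Bijection.to π x) (Bijection.to π y)
embedding-preserves-tilde G π emb (inj₁ xy∈G) = emb _ _ xy∈G
embedding-preserves-tilde G π emb (inj₂ (_ , solid)) = solid π emb

lemma5 : (n : ℕ) (G : SpanningSubgraph n) (x y : V n) →
    Adj x y → AtLeast4Staples G x y → EdgeTilde G x y
lemma5 n G x y xy (s , s-inj , s∈G̃) = inj₂ (xy , solid)
  where
  solid : (π : V n ⤖ V n) → IsEmbedding G (Bijection.to π) →
    Adj (Bijection.to π x) (Bijection.to π y)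
  solid π emb = four-staple-images-adjacent (Bijection.to π) (Bijection.injective π) xy
    s s-inj (λ k → proj₁ (s∈G̃ k)) walk
    where
    walk : ∀ k → MapsStapleToWalk (Bijection.to π) x y (s k)
    walk k = let (_ , xx' , x'y' , y'y) = s∈G̃ k in
      embedding-preserves-tilde G π emb xx' ,
      embedding-preserves-tilde G π emb x'y' ,
      embedding-preserves-tilde G π emb y'y
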